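{- Let $p$ be a prime number and $r$ be a rational number such that $\nu_p(r) \geq 1$. Define $$Q_n(x) := \sum_{k=0}^{\lfloor n/2\rfloor} (-1)^k \binom{n}{k}\binom{2n-2k}{n} x^{n-2k}.$$ Then for every integer $m\geq 0$, $$\nu_p(Q_{2m}(r)) = \nu_p\Big(\binom{2m}{m}\Big).$$
   Context: For a nonzero rational $r$, $\nu_p(r)$ is its $p$-adic valuation (exponent of $p$ in $r$), and $\nu_p(0)=+\infty$. (One has $Q_n(x)=2^nP_n(x)$ with $P_n$ the Legendre polynomial.) -}

module Defs where

open import Data.Nat as ℕ using (ℕ; zero; suc; _∸_; NonZero)
open import Data.Nat.Divisibility using (_∣?_)
open import Data.Nat.Combinatorics using (_C_)
open import Data.Integer as ℤ using (ℤ; +_; -[1+_])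
open import Data.Rational as ℚ using (ℚ; ↥_; ↧ₙ_; _+_; _*_; -_)
open import Data.List using (List; upTo; map; foldr)
open import Relation.Nullary using (yes; no)

-- Computed by repeated division, with fuel n
-- (which is enough since p^e ≤ n).  Returns 0 for n = 0 or p ≤ 1
-- (these cases are never used with nonzero arguments / prime p).
νℕ-go : (p : ℕ) → ℕ → ℕ → ℕ
νℕ-go zero          _        _ = 0
νℕ-go (suc zero)    _        _ = 0
νℕ-go (suc (suc k)) zero     _ = 0
νℕ-go (suc (suc k)) (suc f)  n with n ℕ.≟ 0 | suc (suc k) ∣? n
... | yes _ | _     = 0
... | no _  | yes _ = suc (νℕ-go (suc (suc k)) f (n ℕ./ suc (suc k)))
... | no _  | no _  = 0

νℕ : ℕ → ℕ → ℕ
νℕ p n = νℕ-go p n n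

data ℤ∞ : Set where
  fin : ℤ → ℤ∞
  ∞   : ℤ∞

data _≤∞_ : ℤ∞ → ℤ∞ → Set where
  fin≤fin : ∀ {a b} → a ℤ.≤ b → fin a ≤∞ fin b
  _≤∞∞    : ∀ x → x ≤∞ ∞

νℚ : ℕ → ℚ → ℤ∞
νℚ p r with ℤ.∣ ↥ r ∣
... | zero  = ∞
... | suc a = fin (+ νℕ p (suc a) ℤ.- + νℕ p (↧ₙ r))

sumTo : ℕ → (ℕ → ℚ) → ℚ
sumTo n f = foldr _+_ ℚ.0ℚ (map f (upTo (suc n)))

sgn : ℕ → ℚ
sgn zero    = ℚ.1ℚ
sgn (suc k) = - sgn k

ℕ→ℚ : ℕ → ℚ
ℕ→ℚ n = + n ℚ./ 1

infixr 8 _^_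
_^_ : ℚ → ℕ → ℚ
x ^ zero  = ℚ.1ℚ
x ^ suc n = x * (x ^ n)

Q : ℕ → ℚ → ℚ
Q n x = sumTo (n ℕ./ 2) (λ k →
          sgn k * ℕ→ℚ ((n C k) ℕ.* ((2 ℕ.* n ∸ 2 ℕ.* k) C n)) * (x ^ (n ∸ 2 ℕ.* k)))

-- Write r = a/b in lowest terms; then p ∣ a and p ∤ b. The integer N = b^{2m} Q_{2m}(r) is a sum whose
-- k = m term is ±C(2m,m) b^{2m}, of valuation exactly ν_p C(2m,m), while the term k = m − j (j ≥ 1) carries
-- the factor a^{2j}. Legendre's recursion ν_p(n!) = ⌊n/p⌋ + ν_p(⌊n/p⌋!) gives ν_p(n!) < n, and
-- ν_p((2n)!) − ν_p(n!) increases with n because n + 1 ∣ 2n + 2. Together these yield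
-- ν_p C(2m,k) + ν_p C(2m+2j,2m) + 2j > ν_p C(2m,m), so every other term is divisible by p^{ν_p C(2m,m) + 1}.
-- Hence ν_p(N) = ν_p C(2m,m), and dividing by b^{2m} does not change the valuation.
module Submission where

open import Algebra.Bundles using (CommutativeMonoid)
open import Data.Integer.Base as ℤ using (ℤ)
import Data.Integer.Divisibility.Signed as ℤ
import Data.Integer.Properties as ℤ
open import Data.Integer.Tactic.RingSolver using () renaming (solve-∀ to solve-∀ℤ)
open import Data.List.Base using (List; []; _∷_; _∷ʳ_; foldr; map; upTo)
open import Data.List.Membership.Propositional.Properties using (∈-upTo⁻)
open import Data.List.Properties using (upTo-∷ʳ; map-++)
open import Data.List.Relation.Unary.All using (All; []; _∷_; tabulate)
open import Data.List.Relation.Unary.All.Properties using (map⁺)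
open import Data.Nat.Base
open import Data.Nat.Combinatorics using (_C_; nCn≡1; nCk≡n!/k![n-k]!; k![n∸k]!∣n!)
import Data.Nat.Coprimality as Coprime
open import Data.Nat.Divisibility
open import Data.Nat.DivMod using (_/_; _%_; m*[n/m]≡n; m/n<m; m%n<n; m≡m%n+[m/n]*n; m/n*n≤m; m/n*n≡m; m*n/n≡m)
open import Data.Nat.Induction using (<-wellFounded)
open import Data.Nat.Primality using (Prime; euclidsLemma; prime⇒nonTrivial; prime⇒nonZero)
open import Data.Nat.Properties
open import Data.Nat.Tactic.RingSolver using (solve-∀)
open import Data.Product.Base using (∃; _×_; _,_)
open import Data.Rational.Base as ℚ using (ℚ; ↥_; ↧_; ↧ₙ_)
import Data.Rational.Properties as ℚ
import Data.Rational.Unnormalised.Base as ℚᵘ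
import Data.Rational.Unnormalised.Properties as ℚᵘ
open import Data.Sum.Base using (inj₁; inj₂)
open import Induction.WellFounded using (Acc; acc)
open import Relation.Binary.Definitions using (tri<; tri≈; tri>)
open import Relation.Binary.PropositionalEquality
open import Relation.Nullary using (¬_; yes; no; contradiction)

open import Algebra.Properties.CommutativeSemigroup *-commutativeSemigroup
  using () renaming (interchange to *-interchange)
open import Algebra.Properties.CommutativeSemigroup (CommutativeMonoid.commutativeSemigroup ℚ.*-1-commutativeMonoid)
  using () renaming (interchange to ℚ*-interchange; x∙yz≈y∙xz to ℚ*-x∙yz≈y∙xz)

open import Defs renaming (_^_ to _^ℚ_)

infix 4 _^_∥_

record _^_∥_ (p e n : ℕ) : Set where
  constructor exactly
  field
    pow∣ : p ^ e ∣ n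
    pow∤ : ¬ p ^ suc e ∣ n
open _^_∥_ public

private
  variable
    p e f k n a b : ℕ
    x y i : ℤ

^-monoʳ-∣ : ∀ p → a ≤ b → p ^ a ∣ p ^ b
^-monoʳ-∣ {a} {b} p a≤b = divides (p ^ (b ∸ a)) (begin
  p ^ b               ≡⟨ cong (p ^_) (m+[n∸m]≡n a≤b) ⟨
  p ^ (a + (b ∸ a))   ≡⟨ ^-distribˡ-+-* p a (b ∸ a) ⟩
  p ^ a * p ^ (b ∸ a) ≡⟨ *-comm (p ^ a) _ ⟩
  p ^ (b ∸ a) * p ^ a ∎)
  where open ≡-Reasoning

^-monoˡ-∣ : ∀ n → a ∣ b → a ^ n ∣ b ^ n
^-monoˡ-∣ zero    a∣b = ∣-refl
^-monoˡ-∣ (suc n) a∣b = *-pres-∣ a∣b (^-monoˡ-∣ n a∣b)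

∥-unique : p ^ e ∥ n → p ^ f ∥ n → e ≡ f
∥-unique {p} {e} {n} {f} p^e∥n p^f∥n with <-cmp e f
... | tri< e<f _ _ = contradiction (∣-trans (^-monoʳ-∣ p e<f) (pow∣ p^f∥n)) (pow∤ p^e∥n)
... | tri≈ _ e≡f _ = e≡f
... | tri> _ _ f<e = contradiction (∣-trans (^-monoʳ-∣ p f<e) (pow∣ p^e∥n)) (pow∤ p^f∥n)

∥⇒>0 : p ^ e ∥ n → n > 0
∥⇒>0 {n = zero}  p^e∥0 = contradiction (_∣0 _) (pow∤ p^e∥0)
∥⇒>0 {n = suc n} _     = z<s

∥⇒cofactor : p ^ e ∥ n → ∃ λ u → n ≡ p ^ e * u × ¬ p ∣ u
∥⇒cofactor {p} {e} {n} (exactly (divides u n≡u*p^e) p^[1+e]∤n) = u , n≡p^e*u , p∤u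
  where
  n≡p^e*u : n ≡ p ^ e * u
  n≡p^e*u = trans n≡u*p^e (*-comm u (p ^ e))
  p∤u : ¬ p ∣ u
  p∤u p∣u = p^[1+e]∤n (subst₂ _∣_ (*-comm (p ^ e) p) (sym n≡p^e*u) (*-monoʳ-∣ (p ^ e) p∣u))

cofactor⇒∥ : .{{NonZero p}} → ∀ u → n ≡ p ^ e * u → ¬ p ∣ u → p ^ e ∥ n
cofactor⇒∥ {p} {n} {e} u n≡p^e*u p∤u = exactly (divides u (trans n≡p^e*u (*-comm (p ^ e) u))) λ p^[1+e]∣n →
  p∤u (*-cancelˡ-∣ (p ^ e) {{m^n≢0 p e}} (subst₂ _∣_ (*-comm p (p ^ e)) n≡p^e*u p^[1+e]∣n))

∤⇒∥0 : ¬ p ∣ n → p ^ 0 ∥ n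
∤⇒∥0 {p} {n} p∤n = exactly (1∣ n) (λ p*1∣n → p∤n (subst (_∣ n) (*-identityʳ p) p*1∣n))

∥-* : Prime p → p ^ e ∥ a → p ^ f ∥ b → p ^ (e + f) ∥ a * b
∥-* {p} {e} {a} {f} {b} p-prime p^e∥a p^f∥b
  with u , refl , p∤u ← ∥⇒cofactor p^e∥a | w , refl , p∤w ← ∥⇒cofactor p^f∥b =
  cofactor⇒∥ {{prime⇒nonZero p-prime}} (u * w) (begin
    p ^ e * u * (p ^ f * w)   ≡⟨ *-interchange (p ^ e) u (p ^ f) w ⟩
    p ^ e * p ^ f * (u * w)   ≡⟨ cong (_* (u * w)) (^-distribˡ-+-* p e f) ⟨
    p ^ (e + f) * (u * w)     ∎) p∤uw
  where
  open ≡-Reasoning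
  p∤uw : ¬ p ∣ u * w
  p∤uw p∣uw with euclidsLemma u w p-prime p∣uw
  ... | inj₁ p∣u = p∤u p∣u
  ... | inj₂ p∣w = p∤w p∣w

∥-p* : .{{NonZero p}} → p ^ e ∥ n → p ^ suc e ∥ p * n
∥-p* {p} p^e∥n = exactly (*-monoʳ-∣ p (pow∣ p^e∥n)) (λ p^[2+e]∣pn → pow∤ p^e∥n (*-cancelˡ-∣ p p^[2+e]∣pn))

νℕ-go-∥ : ∀ f → 1 < p → n > 0 → n ≤ f → p ^ νℕ-go p f n ∥ n
νℕ-go-∥ {n = n} zero _ n>0 n≤0 = contradiction (<-≤-trans n>0 n≤0) (λ ())
νℕ-go-∥ {p@(2+ _)} {n} (suc f) 1<p@(s≤s (s≤s z≤n)) n>0 n≤1+f with n ≟ 0 | p ∣? n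
... | yes n≡0 | _      = contradiction n≡0 (≢-nonZero⁻¹ n {{>-nonZero n>0}})
... | no _    | no p∤n = ∤⇒∥0 p∤n
... | no n≢0  | yes p∣n = subst (p ^ suc (νℕ-go p f q) ∥_) p*q≡n (∥-p* (νℕ-go-∥ f 1<p q>0 q≤f))
  where
  instance _ = ≢-nonZero n≢0
  q = n / p
  p*q≡n : p * q ≡ n
  p*q≡n = m*[n/m]≡n p∣n
  q>0 : q > 0
  q>0 = n≢0⇒n>0 (λ q≡0 → n≢0 (trans (sym p*q≡n) (trans (cong (p *_) q≡0) (*-zeroʳ p))))
  q≤f : q ≤ f
  q≤f = ≤-pred (<-≤-trans (m/n<m n p 1<p) n≤1+f)

νℕ-∥ : 1 < p → n > 0 → p ^ νℕ p n ∥ n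
νℕ-∥ 1<p n>0 = νℕ-go-∥ _ 1<p n>0 ≤-refl

νℕ-unique : 1 < p → p ^ e ∥ n → νℕ p n ≡ e
νℕ-unique 1<p p^e∥n = ∥-unique (νℕ-∥ 1<p (∥⇒>0 p^e∥n)) p^e∥n

-- g − f is monotone, phrased without truncated subtraction.
difference-mono : ∀ (f g : ℕ → ℕ) → (∀ n → f (suc n) + g n ≤ g (suc n) + f n) →
                   a ≤ b → f b + g a ≤ g b + f a
difference-mono {a} f g step a≤b = go (≤⇒≤′ a≤b)
  where
  go : a ≤′ b → f b + g a ≤ g b + f a
  go ≤′-refl = ≤-reflexive (+-comm (f a) (g a))
  go (≤′-step {b} a≤′b) = +-cancelʳ-≤ (g b + f b) _ _ (begin
    f (suc b) + g a + (g b + f b)   ≡⟨ shuffle (f (suc b)) (g a) (g b) (f b) ⟩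
    (f (suc b) + g b) + (f b + g a) ≤⟨ +-mono-≤ (step b) (go a≤′b) ⟩
    (g (suc b) + f b) + (g b + f a) ≡⟨ shuffle′ (g (suc b)) (f b) (g b) (f a) ⟩
    g (suc b) + f a + (g b + f b)   ∎)
    where
    open ≤-Reasoning
    shuffle : ∀ x y z w → x + y + (z + w) ≡ (x + z) + (w + y)
    shuffle = solve-∀
    shuffle′ : ∀ x y z w → (x + y) + (z + w) ≡ x + w + (z + y)
    shuffle′ = solve-∀

nCk*[k!*[n∸k]!]≡n! : k ≤ n → (n C k) * (k ! * (n ∸ k) !) ≡ n !
nCk*[k!*[n∸k]!]≡n! {k} {n} k≤n = begin
  (n C k) * (k ! * (n ∸ k) !)                                       ≡⟨ cong (_* (k ! * (n ∸ k) !)) (nCk≡n!/k![n-k]! k≤n) ⟩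
  (n ! / (k ! * (n ∸ k) !)) {{k !* (n ∸ k) !≢0}} * (k ! * (n ∸ k) !) ≡⟨ m/n*n≡m {{k !* (n ∸ k) !≢0}} (k![n∸k]!∣n! k≤n) ⟩
  n !                                                               ∎
  where open ≡-Reasoning

nCk>0 : k ≤ n → n C k > 0
nCk>0 {k} {n} k≤n = n≢0⇒n>0 λ nCk≡0 → contradiction
  (trans (sym (nCk*[k!*[n∸k]!]≡n! k≤n)) (cong (_* (k ! * (n ∸ k) !)) nCk≡0)) (≢-nonZero⁻¹ (n !) {{n !≢0}})

∣i^n∣≡∣i∣^n : ∀ i n → ℤ.∣ i ℤ.^ n ∣ ≡ ℤ.∣ i ∣ ^ n
∣i^n∣≡∣i∣^n i zero    = refl
∣i^n∣≡∣i∣^n i (suc n) = trans (ℤ.abs-* i (i ℤ.^ n)) (cong (ℤ.∣ i ∣ *_) (∣i^n∣≡∣i∣^n i n))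

∥-+-dominant : ℤ.+ (p ^ suc e) ℤ.∣ x → p ^ e ∥ ℤ.∣ y ∣ → p ^ e ∥ ℤ.∣ x ℤ.+ y ∣
∥-+-dominant {p} {e} {x} {y} p^[1+e]∣x p^e∥y = exactly
  (ℤ.∣⇒∣ᵤ {ℤ.+ (p ^ e)} (ℤ.∣m∣n⇒∣m+n (ℤ.∣-trans (ℤ.∣ᵤ⇒∣ (^-monoʳ-∣ p (n≤1+n e))) p^[1+e]∣x) (ℤ.∣ᵤ⇒∣ (pow∣ p^e∥y))))
  (λ p^[1+e]∣x+y → pow∤ p^e∥y (ℤ.∣⇒∣ᵤ (ℤ.∣m+n∣m⇒∣n (ℤ.∣ᵤ⇒∣ p^[1+e]∣x+y) p^[1+e]∣x)))

sumℤ : List ℤ → ℤ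
sumℤ = foldr ℤ._+_ (ℤ.+ 0)

sumℤ-∷ʳ : ∀ xs x → sumℤ (xs ∷ʳ x) ≡ sumℤ xs ℤ.+ x
sumℤ-∷ʳ []       x = trans (ℤ.+-identityʳ x) (sym (ℤ.+-identityˡ x))
sumℤ-∷ʳ (y ∷ xs) x = trans (cong (λ s → y ℤ.+ s) (sumℤ-∷ʳ xs x)) (sym (ℤ.+-assoc y (sumℤ xs) x))

∣-sumℤ : ∀ {d xs} → All (d ℤ.∣_) xs → d ℤ.∣ sumℤ xs
∣-sumℤ []           = ℤ.divides (ℤ.+ 0) refl
∣-sumℤ (d∣x ∷ d∣xs) = ℤ.∣m∣n⇒∣m+n d∣x (∣-sumℤ d∣xs)

-- Qnum a b n = b^n Q_n(a/b). On the summation range 2k ≤ n the exponent n ∸ (n ∸ 2k) of b is 2k;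
-- writing it this way makes the clearing of denominators hold term by term for every k.
Qcoeff : ℕ → ℕ → ℕ
Qcoeff n k = (n C k) * ((2 * n ∸ 2 * k) C n)

Qterm : ℤ → ℤ → ℕ → ℕ → ℤ
Qterm a b n k = ℤ.-1ℤ ℤ.^ k ℤ.* ℤ.+ Qcoeff n k ℤ.* (a ℤ.^ (n ∸ 2 * k) ℤ.* b ℤ.^ (n ∸ (n ∸ 2 * k)))

Qnum : ℤ → ℤ → ℕ → ℤ
Qnum a b n = sumℤ (map (Qterm a b n) (upTo (suc (n / 2))))

Qnum-split : ∀ a b n → Qnum a b (2 * n) ≡ sumℤ (map (Qterm a b (2 * n)) (upTo n)) ℤ.+ Qterm a b (2 * n) n
Qnum-split a b n = begin
  sumℤ (map g (upTo (suc (2 * n / 2))))  ≡⟨ cong (λ h → sumℤ (map g (upTo (suc h)))) 2n/2≡n ⟩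
  sumℤ (map g (upTo (suc n)))            ≡⟨ cong (λ xs → sumℤ (map g xs)) (upTo-∷ʳ n) ⟨
  sumℤ (map g (upTo n ∷ʳ n))             ≡⟨ cong sumℤ (map-++ g (upTo n) (n ∷ [])) ⟩
  sumℤ (map g (upTo n) ∷ʳ g n)           ≡⟨ sumℤ-∷ʳ (map g (upTo n)) (g n) ⟩
  sumℤ (map g (upTo n)) ℤ.+ g n          ∎
  where
  open ≡-Reasoning
  g = Qterm a b (2 * n)
  2n/2≡n : 2 * n / 2 ≡ n
  2n/2≡n = trans (cong (_/ 2) (*-comm 2 n)) (m*n/n≡m n 2)

ι : ℤ → ℚ
ι z = z ℚ./ 1

toℚᵘ-ι : ∀ z → ℚ.toℚᵘ (ι z) ℚᵘ.≃ ℚᵘ.mkℚᵘ z 0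
toℚᵘ-ι z = ℚ.toℚᵘ-fromℚᵘ (ℚᵘ.mkℚᵘ z 0)

ι-* : ∀ x y → ι (x ℤ.* y) ≡ ι x ℚ.* ι y
ι-* x y = ℚ.toℚᵘ-injective (ℚᵘ.≃-trans (toℚᵘ-ι (x ℤ.* y))
  (ℚᵘ.≃-sym (ℚᵘ.≃-trans (ℚ.toℚᵘ-homo-* (ι x) (ι y)) (ℚᵘ.*-cong (toℚᵘ-ι x) (toℚᵘ-ι y)))))

ι-+ : ∀ x y → ι (x ℤ.+ y) ≡ ι x ℚ.+ ι y
ι-+ x y = ℚ.toℚᵘ-injective (ℚᵘ.≃-trans (toℚᵘ-ι (x ℤ.+ y))
  (ℚᵘ.≃-sym (ℚᵘ.≃-trans (ℚ.toℚᵘ-homo-+ (ι x) (ι y))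
    (ℚᵘ.≃-trans (ℚᵘ.+-cong (toℚᵘ-ι x) (toℚᵘ-ι y)) (ℚᵘ.*≡* (x*1+y*1≡[x+y]*[1*1] x y))))))
  where
  x*1+y*1≡[x+y]*[1*1] : ∀ x y → (x ℤ.* ℤ.+ 1 ℤ.+ y ℤ.* ℤ.+ 1) ℤ.* ℤ.+ 1 ≡ (x ℤ.+ y) ℤ.* (ℤ.+ 1 ℤ.* ℤ.+ 1)
  x*1+y*1≡[x+y]*[1*1] = solve-∀ℤ

sgn≡ι[-1^k] : ∀ k → sgn k ≡ ι (ℤ.-1ℤ ℤ.^ k)
sgn≡ι[-1^k] zero    = refl
sgn≡ι[-1^k] (suc k) = begin
  ℚ.- sgn k                          ≡⟨ cong ℚ.-_ (ℚ.*-identityˡ (sgn k)) ⟨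
  ℚ.- (ℚ.1ℚ ℚ.* sgn k)               ≡⟨ ℚ.neg-distribˡ-* ℚ.1ℚ (sgn k) ⟩
  ι ℤ.-1ℤ ℚ.* sgn k                  ≡⟨ cong (ι ℤ.-1ℤ ℚ.*_) (sgn≡ι[-1^k] k) ⟩
  ι ℤ.-1ℤ ℚ.* ι (ℤ.-1ℤ ℤ.^ k)        ≡⟨ ι-* ℤ.-1ℤ (ℤ.-1ℤ ℤ.^ k) ⟨
  ι (ℤ.-1ℤ ℤ.^ suc k)                ∎
  where open ≡-Reasoning

ι[↧]*q≡ι[↥] : ∀ q → ι (↧ q) ℚ.* q ≡ ι (↥ q)
ι[↧]*q≡ι[↥] q@(ℚ.mkℚ a d _) = ℚ.toℚᵘ-injective (ℚᵘ.≃-trans (ℚ.toℚᵘ-homo-* (ι (↧ q)) q)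
  (ℚᵘ.≃-trans (ℚᵘ.*-cong (toℚᵘ-ι (↧ q)) (ℚᵘ.≃-refl {ℚ.toℚᵘ q})) (ℚᵘ.≃-trans (ℚᵘ.*≡* (db*1≡a*[1*b] a (↧ q))) (ℚᵘ.≃-sym (toℚᵘ-ι a)))))
  where
  db*1≡a*[1*b] : ∀ a b → (b ℤ.* a) ℤ.* ℤ.+ 1 ≡ a ℤ.* (ℤ.+ 1 ℤ.* b)
  db*1≡a*[1*b] = solve-∀ℤ

ι[↧^e]*q^e≡ι[↥^e] : ∀ q e → ι (↧ q ℤ.^ e) ℚ.* q ^ℚ e ≡ ι (↥ q ℤ.^ e)
ι[↧^e]*q^e≡ι[↥^e] q zero    = ℚ.*-identityʳ (ι (ℤ.+ 1))
ι[↧^e]*q^e≡ι[↥^e] q (suc e) = begin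
  ι (↧ q ℤ.* ↧ q ℤ.^ e) ℚ.* (q ℚ.* q ^ℚ e)      ≡⟨ cong (ℚ._* (q ℚ.* q ^ℚ e)) (ι-* (↧ q) (↧ q ℤ.^ e)) ⟩
  ι (↧ q) ℚ.* ι (↧ q ℤ.^ e) ℚ.* (q ℚ.* q ^ℚ e)  ≡⟨ ℚ*-interchange (ι (↧ q)) _ q _ ⟩
  ι (↧ q) ℚ.* q ℚ.* (ι (↧ q ℤ.^ e) ℚ.* q ^ℚ e)  ≡⟨ cong₂ ℚ._*_ (ι[↧]*q≡ι[↥] q) (ι[↧^e]*q^e≡ι[↥^e] q e) ⟩
  ι (↥ q) ℚ.* ι (↥ q ℤ.^ e)                     ≡⟨ ι-* (↥ q) (↥ q ℤ.^ e) ⟨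
  ι (↥ q ℤ.^ suc e)                             ∎
  where open ≡-Reasoning

ι[↧^n]*q^e≡ι[↥^e*↧^[n∸e]] : ∀ q {e n} → e ≤ n → ι (↧ q ℤ.^ n) ℚ.* q ^ℚ e ≡ ι (↥ q ℤ.^ e ℤ.* ↧ q ℤ.^ (n ∸ e))
ι[↧^n]*q^e≡ι[↥^e*↧^[n∸e]] q {e} {n} e≤n = begin
  ι (↧ q ℤ.^ n) ℚ.* q ^ℚ e                             ≡⟨ cong (λ x → ι x ℚ.* q ^ℚ e) ↧^n≡↧^[n∸e]*↧^e ⟩
  ι (↧ q ℤ.^ (n ∸ e) ℤ.* ↧ q ℤ.^ e) ℚ.* q ^ℚ e         ≡⟨ cong (ℚ._* q ^ℚ e) (ι-* (↧ q ℤ.^ (n ∸ e)) (↧ q ℤ.^ e)) ⟩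
  ι (↧ q ℤ.^ (n ∸ e)) ℚ.* ι (↧ q ℤ.^ e) ℚ.* q ^ℚ e     ≡⟨ ℚ.*-assoc (ι (↧ q ℤ.^ (n ∸ e))) _ _ ⟩
  ι (↧ q ℤ.^ (n ∸ e)) ℚ.* (ι (↧ q ℤ.^ e) ℚ.* q ^ℚ e)   ≡⟨ cong (ι (↧ q ℤ.^ (n ∸ e)) ℚ.*_) (ι[↧^e]*q^e≡ι[↥^e] q e) ⟩
  ι (↧ q ℤ.^ (n ∸ e)) ℚ.* ι (↥ q ℤ.^ e)                ≡⟨ ι-* (↧ q ℤ.^ (n ∸ e)) (↥ q ℤ.^ e) ⟨
  ι (↧ q ℤ.^ (n ∸ e) ℤ.* ↥ q ℤ.^ e)                    ≡⟨ cong ι (ℤ.*-comm (↧ q ℤ.^ (n ∸ e)) (↥ q ℤ.^ e)) ⟩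
  ι (↥ q ℤ.^ e ℤ.* ↧ q ℤ.^ (n ∸ e))                    ∎
  where
  open ≡-Reasoning
  ↧^n≡↧^[n∸e]*↧^e : ↧ q ℤ.^ n ≡ ↧ q ℤ.^ (n ∸ e) ℤ.* ↧ q ℤ.^ e
  ↧^n≡↧^[n∸e]*↧^e = trans (cong (↧ q ℤ.^_) (sym (m∸n+n≡m e≤n))) (ℤ.^-distribˡ-+-* (↧ q) (n ∸ e) e)

*-foldr≡ι-sumℤ : ∀ c (f : ℕ → ℚ) (g : ℕ → ℤ) → (∀ k → c ℚ.* f k ≡ ι (g k)) →
                 ∀ xs → c ℚ.* foldr ℚ._+_ ℚ.0ℚ (map f xs) ≡ ι (sumℤ (map g xs))
*-foldr≡ι-sumℤ c f g c*f≡ι∘g []       = ℚ.*-zeroʳ c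
*-foldr≡ι-sumℤ c f g c*f≡ι∘g (x ∷ xs) = begin
  c ℚ.* (f x ℚ.+ foldr ℚ._+_ ℚ.0ℚ (map f xs))           ≡⟨ ℚ.*-distribˡ-+ c (f x) _ ⟩
  c ℚ.* f x ℚ.+ c ℚ.* foldr ℚ._+_ ℚ.0ℚ (map f xs)       ≡⟨ cong₂ ℚ._+_ (c*f≡ι∘g x) (*-foldr≡ι-sumℤ c f g c*f≡ι∘g xs) ⟩
  ι (g x) ℚ.+ ι (sumℤ (map g xs))                       ≡⟨ ι-+ (g x) (sumℤ (map g xs)) ⟨
  ι (g x ℤ.+ sumℤ (map g xs))                           ∎
  where open ≡-Reasoning

Q-cleared : ∀ n r → ι (↧ r ℤ.^ n) ℚ.* Q n r ≡ ι (Qnum (↥ r) (↧ r) n)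
Q-cleared n r = *-foldr≡ι-sumℤ (ι (↧ r ℤ.^ n)) _ (Qterm (↥ r) (↧ r) n) term (upTo (suc (n / 2)))
  where
  term : ∀ k → ι (↧ r ℤ.^ n) ℚ.* (sgn k ℚ.* ℕ→ℚ (Qcoeff n k) ℚ.* r ^ℚ (n ∸ 2 * k)) ≡ ι (Qterm (↥ r) (↧ r) n k)
  term k = begin
    ι (↧ r ℤ.^ n) ℚ.* (sgn k ℚ.* ℕ→ℚ c ℚ.* r ^ℚ t)
      ≡⟨ ℚ*-x∙yz≈y∙xz (ι (↧ r ℤ.^ n)) (sgn k ℚ.* ℕ→ℚ c) (r ^ℚ t) ⟩
    sgn k ℚ.* ℕ→ℚ c ℚ.* (ι (↧ r ℤ.^ n) ℚ.* r ^ℚ t)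
      ≡⟨ cong₂ (λ x y → x ℚ.* ℕ→ℚ c ℚ.* y) (sgn≡ι[-1^k] k) (ι[↧^n]*q^e≡ι[↥^e*↧^[n∸e]] r (m∸n≤m n (2 * k))) ⟩
    ι (ℤ.-1ℤ ℤ.^ k) ℚ.* ι (ℤ.+ c) ℚ.* ι (↥ r ℤ.^ t ℤ.* ↧ r ℤ.^ (n ∸ t))
      ≡⟨ cong (ℚ._* ι (↥ r ℤ.^ t ℤ.* ↧ r ℤ.^ (n ∸ t))) (ι-* (ℤ.-1ℤ ℤ.^ k) (ℤ.+ c)) ⟨
    ι (ℤ.-1ℤ ℤ.^ k ℤ.* ℤ.+ c) ℚ.* ι (↥ r ℤ.^ t ℤ.* ↧ r ℤ.^ (n ∸ t))
      ≡⟨ ι-* (ℤ.-1ℤ ℤ.^ k ℤ.* ℤ.+ c) (↥ r ℤ.^ t ℤ.* ↧ r ℤ.^ (n ∸ t)) ⟨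
    ι (Qterm (↥ r) (↧ r) n k)                                ∎
    where
    open ≡-Reasoning
    c = Qcoeff n k
    t = n ∸ 2 * k

ι*q≡ι⇒↥q*B≡N*↧q : ∀ B N q → ι B ℚ.* q ≡ ι N → ↥ q ℤ.* B ≡ N ℤ.* ↧ q
ι*q≡ι⇒↥q*B≡N*↧q B N q@(ℚ.mkℚ a d _) ιB*q≡ιN
  with ℚᵘ.*≡* eq ← ℚᵘ.≃-trans (ℚᵘ.≃-sym (ℚᵘ.*-cong (toℚᵘ-ι B) (ℚᵘ.≃-refl {ℚ.toℚᵘ q})))
                    (ℚᵘ.≃-trans (ℚᵘ.≃-sym (ℚ.toℚᵘ-homo-* (ι B) q)) (ℚᵘ.≃-trans (ℚ.toℚᵘ-cong ιB*q≡ιN) (toℚᵘ-ι N)))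
  = trans (a*B≡[B*a]*1 a B) (trans eq (N*[1*b]≡N*b N (↧ q)))
  where
  a*B≡[B*a]*1 : ∀ a B → a ℤ.* B ≡ (B ℤ.* a) ℤ.* ℤ.+ 1
  a*B≡[B*a]*1 = solve-∀ℤ
  N*[1*b]≡N*b : ∀ N b → N ℤ.* (ℤ.+ 1 ℤ.* b) ≡ N ℤ.* b
  N*[1*b]≡N*b = solve-∀ℤ

↥-coprime-↧ : ∀ q → Coprime.Coprime ℤ.∣ ↥ q ∣ (↧ₙ q)
↥-coprime-↧ (ℚ.mkℚ _ _ coprime) = Coprime.recompute coprime

νℚ-nonzero : ∀ p q → ℤ.∣ ↥ q ∣ > 0 → νℚ p q ≡ fin (ℤ.+ νℕ p ℤ.∣ ↥ q ∣ ℤ.- ℤ.+ νℕ p (↧ₙ q))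
νℚ-nonzero p q ∣↥q∣>0 with ℤ.∣ ↥ q ∣
... | suc _ = refl

module Valuation {p : ℕ} (p-prime : Prime p) where

  1<p : 1 < p
  1<p = nonTrivial⇒n>1 p {{prime⇒nonTrivial p-prime}}

  instance
    p≢0 : NonZero p
    p≢0 = prime⇒nonZero p-prime

  νℕ-* : a > 0 → b > 0 → νℕ p (a * b) ≡ νℕ p a + νℕ p b
  νℕ-* a>0 b>0 = νℕ-unique 1<p (∥-* p-prime (νℕ-∥ 1<p a>0) (νℕ-∥ 1<p b>0))

  νℕ≡0 : ¬ p ∣ n → νℕ p n ≡ 0
  νℕ≡0 p∤n = νℕ-unique 1<p (∤⇒∥0 p∤n)

  νℕ-self : νℕ p p ≡ 1
  νℕ-self = νℕ-unique 1<p (cofactor⇒∥ 1 (sym (trans (*-identityʳ (p * 1)) (*-identityʳ p))) (>⇒∤ 1<p))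

  ^∣⇒≤νℕ : n > 0 → p ^ e ∣ n → e ≤ νℕ p n
  ^∣⇒≤νℕ {n} {e} n>0 p^e∣n with e ≤? νℕ p n
  ... | yes e≤ν = e≤ν
  ... | no e≰ν = contradiction (∣-trans (^-monoʳ-∣ p (≰⇒> e≰ν)) p^e∣n) (pow∤ (νℕ-∥ 1<p n>0))

  νℕ-mono-∣ : b > 0 → a ∣ b → νℕ p a ≤ νℕ p b
  νℕ-mono-∣ {b} {a} b>0 a∣b = ^∣⇒≤νℕ b>0 (∣-trans (pow∣ (νℕ-∥ 1<p a>0)) a∣b)
    where
    a>0 : a > 0
    a>0 = n≢0⇒n>0 λ { refl → contradiction (0∣⇒≡0 a∣b) (≢-nonZero⁻¹ b {{>-nonZero b>0}}) }

  p^νℕ∣n : ∀ n → p ^ νℕ p n ∣ n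
  p^νℕ∣n zero    = _ ∣0
  p^νℕ∣n (suc n) = pow∣ (νℕ-∥ 1<p z<s)

  ∤-^ : ¬ p ∣ a → ¬ p ∣ a ^ n
  ∤-^ {n = zero}      _   p∣1 = >⇒∤ 1<p p∣1
  ∤-^ {a} {suc n} p∤a p∣a*aⁿ with euclidsLemma a (a ^ n) p-prime p∣a*aⁿ
  ... | inj₁ p∣a  = p∤a p∣a
  ... | inj₂ p∣aⁿ = ∤-^ {n = n} p∤a p∣aⁿ

  0<νℕ⇒p∣n : 0 < νℕ p n → p ∣ n
  0<νℕ⇒p∣n {n} 0<ν = ∣-trans (subst (_∣ p ^ νℕ p n) (*-identityʳ p) (^-monoʳ-∣ p 0<ν)) (p^νℕ∣n n)

  ν! : ℕ → ℕ
  ν! n = νℕ p (n !)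

  ν!-suc : ∀ n → ν! (suc n) ≡ νℕ p (suc n) + ν! n
  ν!-suc n = νℕ-* z<s (1≤n! n)

  ν!-mono : a ≤ b → ν! a ≤ ν! b
  ν!-mono {a} {b} a≤b = νℕ-mono-∣ (1≤n! b) (m≤n⇒m!∣n! a≤b)

  ν![p*q+r]≡ν![p*q] : ∀ q r → r < p → ν! (p * q + r) ≡ ν! (p * q)
  ν![p*q+r]≡ν![p*q] q zero    _   = cong ν! (+-identityʳ (p * q))
  ν![p*q+r]≡ν![p*q] q (suc r) r<p = begin
    ν! (p * q + suc r)                      ≡⟨ cong ν! (+-suc (p * q) r) ⟩
    ν! (suc (p * q + r))                    ≡⟨ ν!-suc (p * q + r) ⟩
    νℕ p (suc (p * q + r)) + ν! (p * q + r) ≡⟨ cong₂ _+_ (νℕ≡0 p∤) (ν![p*q+r]≡ν![p*q] q r (<-trans (n<1+n r) r<p)) ⟩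
    ν! (p * q)                              ∎
    where
    open ≡-Reasoning
    p∤ : ¬ p ∣ suc (p * q + r)
    p∤ p∣ = >⇒∤ r<p (∣m+n∣m⇒∣n (subst (p ∣_) (sym (+-suc (p * q) r)) p∣) (m∣m*n q))

  ν![p*q]≡q+ν![q] : ∀ q → ν! (p * q) ≡ q + ν! q
  ν![p*q]≡q+ν![q] zero    = cong ν! (*-zeroʳ p)
  ν![p*q]≡q+ν![q] (suc q) = begin
    ν! (p * suc q)                          ≡⟨ cong ν! p*[1+q]≡1+p*q+[p-1] ⟩
    ν! (suc (p * q + pred p))               ≡⟨ ν!-suc (p * q + pred p) ⟩
    νℕ p (suc (p * q + pred p)) + ν! (p * q + pred p)
      ≡⟨ cong₂ _+_ (cong (νℕ p) (sym p*[1+q]≡1+p*q+[p-1])) (ν![p*q+r]≡ν![p*q] q (pred p) (m≤pred[n]⇒suc[m]≤n ≤-refl)) ⟩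
    νℕ p (p * suc q) + ν! (p * q)           ≡⟨ cong₂ _+_ (νℕ-* (>-nonZero⁻¹ p) z<s) (ν![p*q]≡q+ν![q] q) ⟩
    (νℕ p p + νℕ p (suc q)) + (q + ν! q)    ≡⟨ cong (λ x → (x + νℕ p (suc q)) + (q + ν! q)) νℕ-self ⟩
    suc (νℕ p (suc q) + (q + ν! q))         ≡⟨ cong suc (x+[y+z]≡y+[x+z] (νℕ p (suc q)) q (ν! q)) ⟩
    suc q + (νℕ p (suc q) + ν! q)           ≡⟨ cong (suc q +_) (ν!-suc q) ⟨
    suc q + ν! (suc q)                      ∎
    where
    open ≡-Reasoning
    p*[1+q]≡1+p*q+[p-1] : p * suc q ≡ suc (p * q + pred p)
    p*[1+q]≡1+p*q+[p-1] = begin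
      p * suc q              ≡⟨ *-suc p q ⟩
      p + p * q              ≡⟨ cong (_+ p * q) (suc-pred p) ⟨
      suc (pred p + p * q)   ≡⟨ cong suc (+-comm (pred p) (p * q)) ⟩
      suc (p * q + pred p)   ∎
    x+[y+z]≡y+[x+z] : ∀ x y z → x + (y + z) ≡ y + (x + z)
    x+[y+z]≡y+[x+z] = solve-∀

  ν!≡n/p+ν![n/p] : ∀ n → ν! n ≡ n / p + ν! (n / p)
  ν!≡n/p+ν![n/p] n = begin
    ν! n                          ≡⟨ cong ν! n≡p*[n/p]+n%p ⟩
    ν! (p * (n / p) + n % p)      ≡⟨ ν![p*q+r]≡ν![p*q] (n / p) (n % p) (m%n<n n p) ⟩
    ν! (p * (n / p))              ≡⟨ ν![p*q]≡q+ν![q] (n / p) ⟩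
    n / p + ν! (n / p)            ∎
    where
    open ≡-Reasoning
    n≡p*[n/p]+n%p : n ≡ p * (n / p) + n % p
    n≡p*[n/p]+n%p = trans (m≡m%n+[m/n]*n n p) (trans (+-comm (n % p) _) (cong (_+ n % p) (*-comm (n / p) p)))

  ν![n]<n : n > 0 → ν! n < n
  ν![n]<n = go _ (<-wellFounded _)
    where
    go : ∀ n → Acc _<_ n → n > 0 → ν! n < n
    go n (acc rec) n>0 = begin-strict
      ν! n               ≡⟨ ν!≡n/p+ν![n/p] n ⟩
      n / p + ν! (n / p) <⟨ bound (n / p) (subst (_≤ n) (*-comm (n / p) p) (m/n*n≤m n p)) ⟩
      n                  ∎
      where
      open ≤-Reasoning
      bound : ∀ q → p * q ≤ n → q + ν! q < n
      bound zero    _     = subst (_< n) (sym (νℕ≡0 (>⇒∤ 1<p))) n>0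
      bound q@(suc _) p*q≤n = <-≤-trans (+-monoʳ-< q (go q (rec q<n) z<s)) q+q≤n
        where
        q+q≤n : q + q ≤ n
        q+q≤n = begin
          q + q  ≡⟨ cong (q +_) (+-identityʳ q) ⟨
          2 * q  ≤⟨ *-monoˡ-≤ q 1<p ⟩
          p * q  ≤⟨ p*q≤n ⟩
          n      ∎
        q<n : q < n
        q<n = <-≤-trans (m<m+n q z<s) q+q≤n

  ν![1+n]+ν![2n]≤ν![2+2n]+ν![n] : ∀ n → ν! (suc n) + ν! (2 * n) ≤ ν! (2 * suc n) + ν! n
  ν![1+n]+ν![2n]≤ν![2+2n]+ν![n] n = begin
    ν! (suc n) + ν! (2 * n)                                    ≡⟨ cong (_+ ν! (2 * n)) (ν!-suc n) ⟩
    νℕ p (suc n) + ν! n + ν! (2 * n)                           ≤⟨ +-mono-≤ (+-monoˡ-≤ (ν! n) ν[1+n]≤ν[2+2n]) (m≤n+m _ _) ⟩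
    νℕ p (2 + 2 * n) + ν! n + (νℕ p (suc (2 * n)) + ν! (2 * n)) ≡⟨ xy∙zw≡xzw∙y (νℕ p (2 + 2 * n)) (ν! n) (νℕ p (suc (2 * n))) (ν! (2 * n)) ⟩
    νℕ p (2 + 2 * n) + (νℕ p (suc (2 * n)) + ν! (2 * n)) + ν! n ≡⟨ cong (λ x → νℕ p (2 + 2 * n) + x + ν! n) (ν!-suc (2 * n)) ⟨
    νℕ p (2 + 2 * n) + ν! (suc (2 * n)) + ν! n                 ≡⟨ cong (_+ ν! n) (ν!-suc (suc (2 * n))) ⟨
    ν! (2 + 2 * n) + ν! n                                      ≡⟨ cong (λ x → ν! x + ν! n) (*-suc 2 n) ⟨
    ν! (2 * suc n) + ν! n                                      ∎
    where
    open ≤-Reasoning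
    ν[1+n]≤ν[2+2n] : νℕ p (suc n) ≤ νℕ p (2 + 2 * n)
    ν[1+n]≤ν[2+2n] = νℕ-mono-∣ z<s (divides 2 (sym (*-suc 2 n)))
    xy∙zw≡xzw∙y : ∀ x y z w → x + y + (z + w) ≡ x + (z + w) + y
    xy∙zw≡xzw∙y = solve-∀

  ν![2n]∸ν![n]-mono : a ≤ b → ν! b + ν! (2 * a) ≤ ν! (2 * b) + ν! a
  ν![2n]∸ν![n]-mono = difference-mono ν! (λ n → ν! (2 * n)) ν![1+n]+ν![2n]≤ν![2+2n]+ν![n]

  νℕ-C : ∀ {n} k l → n ≡ k + l → νℕ p (n C k) + (ν! k + ν! l) ≡ ν! n
  νℕ-C {n} k l refl = begin
    νℕ p (n C k) + (ν! k + ν! l)          ≡⟨ cong (λ x → νℕ p (n C k) + (ν! k + ν! x)) (m+n∸m≡n k l) ⟨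
    νℕ p (n C k) + (ν! k + ν! (n ∸ k))    ≡⟨ cong (νℕ p (n C k) +_) (νℕ-* (1≤n! k) (1≤n! (n ∸ k))) ⟨
    νℕ p (n C k) + νℕ p (k ! * (n ∸ k) !) ≡⟨ νℕ-* (nCk>0 k≤n) (>-nonZero⁻¹ _ {{k !* (n ∸ k) !≢0}}) ⟨
    νℕ p ((n C k) * (k ! * (n ∸ k) !))    ≡⟨ cong (νℕ p) (nCk*[k!*[n∸k]!]≡n! k≤n) ⟩
    ν! n                                  ∎
    where
    open ≡-Reasoning
    k≤n : k ≤ n
    k≤n = m≤m+n k l

  -- With m = k + j, each valuation of a binomial is expressed through ν!; the claim then follows from
  -- ν!(k) ≤ ν!(m), the monotonicity of ν!(2n) − ν!(n) (from m to m + j) and ν!(2j) < 2j.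
  central-binomial-dominates : ∀ k j → j > 0 →
    νℕ p ((2 * (k + j)) C (k + j)) < νℕ p ((2 * (k + j)) C k) + νℕ p ((2 * (k + j) + 2 * j) C (2 * (k + j))) + 2 * j
  central-binomial-dominates k j j>0 = ≤-<-trans E≤c₁+c₂+ν![2j] (+-monoʳ-< (c₁ + c₂) (ν![n]<n {2 * j} (*-monoʳ-< 2 j>0)))
    where
    m = k + j
    E  = νℕ p ((2 * m) C m)
    c₁ = νℕ p ((2 * m) C k)
    c₂ = νℕ p ((2 * m + 2 * j) C (2 * m))
    open ≤-Reasoning
    E≤c₁+c₂+ν![2j] : E ≤ c₁ + c₂ + ν! (2 * j)
    E≤c₁+c₂+ν![2j] = +-cancelʳ-≤ (ν! m + ν! m + ν! (2 * m)) E (c₁ + c₂ + ν! (2 * j)) (begin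
      E + (ν! m + ν! m + ν! (2 * m))               ≡⟨ +-assoc E (ν! m + ν! m) (ν! (2 * m)) ⟨
      E + (ν! m + ν! m) + ν! (2 * m)               ≡⟨ cong (_+ ν! (2 * m)) (νℕ-C m m (cong (m +_) (+-identityʳ m))) ⟩
      ν! (2 * m) + ν! (2 * m)                      ≡⟨ cong (_+ ν! (2 * m)) (νℕ-C k (m + j) (2[k+j]≡k+[k+j+j] k j)) ⟨
      c₁ + (ν! k + ν! (m + j)) + ν! (2 * m)        ≡⟨ shuffle₁ c₁ (ν! k) (ν! (m + j)) (ν! (2 * m)) ⟩
      c₁ + ν! k + (ν! (m + j) + ν! (2 * m))        ≤⟨ +-mono-≤ (+-monoʳ-≤ c₁ (ν!-mono (m≤m+n k j))) ν![m+j]+ν![2m]≤ν![2m+2j]+ν![m] ⟩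
      c₁ + ν! m + (ν! (2 * m + 2 * j) + ν! m)      ≡⟨ cong (λ x → c₁ + ν! m + (x + ν! m)) (νℕ-C (2 * m) (2 * j) refl) ⟨
      c₁ + ν! m + (c₂ + (ν! (2 * m) + ν! (2 * j)) + ν! m) ≡⟨ shuffle₂ c₁ (ν! m) c₂ (ν! (2 * m)) (ν! (2 * j)) ⟩
      c₁ + c₂ + ν! (2 * j) + (ν! m + ν! m + ν! (2 * m)) ∎)
      where
      ν![m+j]+ν![2m]≤ν![2m+2j]+ν![m] : ν! (m + j) + ν! (2 * m) ≤ ν! (2 * m + 2 * j) + ν! m
      ν![m+j]+ν![2m]≤ν![2m+2j]+ν![m] =
        subst (λ x → ν! (m + j) + ν! (2 * m) ≤ ν! x + ν! m) (*-distribˡ-+ 2 m j) (ν![2n]∸ν![n]-mono (m≤m+n m j))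
      2[k+j]≡k+[k+j+j] : ∀ k j → 2 * (k + j) ≡ k + ((k + j) + j)
      2[k+j]≡k+[k+j+j] = solve-∀
      shuffle₁ : ∀ x y z w → x + (y + z) + w ≡ x + y + (z + w)
      shuffle₁ = solve-∀
      shuffle₂ : ∀ x y z w v → x + y + (z + (w + v) + y) ≡ x + z + v + (y + y + w)
      shuffle₂ = solve-∀

  central-binomial-dominates-Qcoeff : k < n → νℕ p ((2 * n) C n) < νℕ p (Qcoeff (2 * n) k) + (2 * n ∸ 2 * k)
  central-binomial-dominates-Qcoeff {k} {n} k<n =
    subst Dominates (m+[n∸m]≡n (<⇒≤ k<n)) (dominates (n ∸ k) (m<n⇒0<n∸m k<n))
    where
    Dominates : ℕ → Set
    Dominates n = νℕ p ((2 * n) C n) < νℕ p (Qcoeff (2 * n) k) + (2 * n ∸ 2 * k)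
    dominates : ∀ j → j > 0 → Dominates (k + j)
    dominates j j>0 = subst₂ (λ c d → νℕ p ((2 * m) C m) < c + d) (sym ν[Qcoeff]) (sym 2m∸2k≡2j)
      (central-binomial-dominates k j j>0)
      where
      m = k + j
      4m∸2k≡2m+2j : 2 * (2 * m) ∸ 2 * k ≡ 2 * m + 2 * j
      4m∸2k≡2m+2j = trans (cong (_∸ 2 * k) (4[k+j]≡2k+[2[k+j]+2j] k j)) (m+n∸m≡n (2 * k) (2 * m + 2 * j))
        where
        4[k+j]≡2k+[2[k+j]+2j] : ∀ k j → 2 * (2 * (k + j)) ≡ 2 * k + (2 * (k + j) + 2 * j)
        4[k+j]≡2k+[2[k+j]+2j] = solve-∀
      2m∸2k≡2j : 2 * m ∸ 2 * k ≡ 2 * j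
      2m∸2k≡2j = trans (cong (_∸ 2 * k) (*-distribˡ-+ 2 k j)) (m+n∸m≡n (2 * k) (2 * j))
      ν[Qcoeff] : νℕ p (Qcoeff (2 * m) k) ≡ νℕ p ((2 * m) C k) + νℕ p ((2 * m + 2 * j) C (2 * m))
      ν[Qcoeff] = trans (cong (λ x → νℕ p (((2 * m) C k) * (x C (2 * m)))) 4m∸2k≡2m+2j)
                        (νℕ-* (nCk>0 (≤-trans (m≤m+n k j) (m≤m+n m (m + 0)))) (nCk>0 (m≤m+n (2 * m) (2 * j))))

  Qterm-divisible : ∀ b → p ∣ ℤ.∣ i ∣ → k < n → ℤ.+ (p ^ suc (νℕ p ((2 * n) C n))) ℤ.∣ Qterm i b (2 * n) k
  Qterm-divisible {i} {k} {n} b p∣i k<n =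
    ℤ.∣-trans (ℤ.∣ᵤ⇒∣ p^[1+E]∣c*∣i∣^t) (ℤ.divides (s ℤ.* b ℤ.^ (2 * n ∸ t)) (rearrange s (ℤ.+ c) (i ℤ.^ t) (b ℤ.^ (2 * n ∸ t))))
    where
    s = ℤ.-1ℤ ℤ.^ k
    c = Qcoeff (2 * n) k
    t = 2 * n ∸ 2 * k
    ∣c*i^t∣≡c*∣i∣^t : ℤ.∣ ℤ.+ c ℤ.* i ℤ.^ t ∣ ≡ c * ℤ.∣ i ∣ ^ t
    ∣c*i^t∣≡c*∣i∣^t = trans (ℤ.abs-* (ℤ.+ c) (i ℤ.^ t)) (cong (c *_) (∣i^n∣≡∣i∣^n i t))
    p^[1+E]∣c*∣i∣^t : p ^ suc (νℕ p ((2 * n) C n)) ∣ ℤ.∣ ℤ.+ c ℤ.* i ℤ.^ t ∣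
    p^[1+E]∣c*∣i∣^t = ∣-trans (^-monoʳ-∣ p (central-binomial-dominates-Qcoeff k<n))
      (subst₂ _∣_ (sym (^-distribˡ-+-* p (νℕ p c) t)) (sym ∣c*i^t∣≡c*∣i∣^t) (*-pres-∣ (p^νℕ∣n c) (^-monoˡ-∣ t p∣i)))
    rearrange : ∀ s c x y → s ℤ.* c ℤ.* (x ℤ.* y) ≡ (s ℤ.* y) ℤ.* (c ℤ.* x)
    rearrange = solve-∀ℤ

  ∣Qterm[central]∣ : ∀ a b n → ℤ.∣ Qterm a b (2 * n) n ∣ ≡ ((2 * n) C n) * ℤ.∣ b ∣ ^ (2 * n)
  ∣Qterm[central]∣ a b n = begin
    ℤ.∣ s ℤ.* ℤ.+ Qcoeff (2 * n) n ℤ.* (a ℤ.^ t ℤ.* b ℤ.^ (2 * n ∸ t)) ∣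
      ≡⟨ ℤ.abs-* (s ℤ.* ℤ.+ Qcoeff (2 * n) n) _ ⟩
    ℤ.∣ s ℤ.* ℤ.+ Qcoeff (2 * n) n ∣ * ℤ.∣ a ℤ.^ t ℤ.* b ℤ.^ (2 * n ∸ t) ∣
      ≡⟨ cong₂ _*_ (ℤ.abs-* s (ℤ.+ Qcoeff (2 * n) n)) (ℤ.abs-* (a ℤ.^ t) (b ℤ.^ (2 * n ∸ t))) ⟩
    ℤ.∣ s ∣ * Qcoeff (2 * n) n * (ℤ.∣ a ℤ.^ t ∣ * ℤ.∣ b ℤ.^ (2 * n ∸ t) ∣)
      ≡⟨ cong₂ (λ x y → x * Qcoeff (2 * n) n * y) ∣s∣≡1 (cong₂ _*_ ∣aᵗ∣≡1 (∣i^n∣≡∣i∣^n b (2 * n ∸ t))) ⟩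
    1 * Qcoeff (2 * n) n * (1 * ℤ.∣ b ∣ ^ (2 * n ∸ t))
      ≡⟨ cong₂ (λ x y → 1 * (((2 * n) C n) * x) * (1 * ℤ.∣ b ∣ ^ y)) [4n∸2n]C2n≡1 2n∸t≡2n ⟩
    1 * (((2 * n) C n) * 1) * (1 * ℤ.∣ b ∣ ^ (2 * n))
      ≡⟨ 1*x*1*[1*y]≡x*y ((2 * n) C n) (ℤ.∣ b ∣ ^ (2 * n)) ⟩
    ((2 * n) C n) * ℤ.∣ b ∣ ^ (2 * n) ∎
    where
    open ≡-Reasoning
    s = ℤ.-1ℤ ℤ.^ n
    t = 2 * n ∸ 2 * n
    ∣s∣≡1 : ℤ.∣ s ∣ ≡ 1
    ∣s∣≡1 = trans (∣i^n∣≡∣i∣^n ℤ.-1ℤ n) (^-zeroˡ n)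
    t≡0 : t ≡ 0
    t≡0 = n∸n≡0 (2 * n)
    ∣aᵗ∣≡1 : ℤ.∣ a ℤ.^ t ∣ ≡ 1
    ∣aᵗ∣≡1 = cong (λ t → ℤ.∣ a ℤ.^ t ∣) t≡0
    2n∸t≡2n : 2 * n ∸ t ≡ 2 * n
    2n∸t≡2n = cong (2 * n ∸_) t≡0
    [4n∸2n]C2n≡1 : (2 * (2 * n) ∸ 2 * n) C (2 * n) ≡ 1
    [4n∸2n]C2n≡1 = trans (cong (_C (2 * n)) (trans (m+n∸m≡n (2 * n) (2 * n + 0)) (+-identityʳ (2 * n)))) (nCn≡1 (2 * n))
    1*x*1*[1*y]≡x*y : ∀ x y → 1 * (x * 1) * (1 * y) ≡ x * y
    1*x*1*[1*y]≡x*y = solve-∀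

  Qnum-∥ : ∀ a b → p ∣ ℤ.∣ a ∣ → ¬ p ∣ ℤ.∣ b ∣ → ∀ n → p ^ νℕ p ((2 * n) C n) ∥ ℤ.∣ Qnum a b (2 * n) ∣
  Qnum-∥ a b p∣a p∤b n = subst (λ x → p ^ E ∥ ℤ.∣ x ∣) (sym (Qnum-split a b n))
    (∥-+-dominant p^[1+E]∣rest (subst (p ^ E ∥_) (sym (∣Qterm[central]∣ a b n)) p^E∥C*∣b∣^2n))
    where
    E = νℕ p ((2 * n) C n)
    p^[1+E]∣rest : ℤ.+ (p ^ suc E) ℤ.∣ sumℤ (map (Qterm a b (2 * n)) (upTo n))
    p^[1+E]∣rest = ∣-sumℤ (map⁺ (tabulate {xs = upTo n} (λ k∈upTo[n] → Qterm-divisible b p∣a (∈-upTo⁻ k∈upTo[n]))))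
    p^E∥C*∣b∣^2n : p ^ E ∥ ((2 * n) C n) * ℤ.∣ b ∣ ^ (2 * n)
    p^E∥C*∣b∣^2n = subst (λ e → p ^ e ∥ ((2 * n) C n) * ℤ.∣ b ∣ ^ (2 * n)) (+-identityʳ E)
      (∥-* p-prime (νℕ-∥ 1<p (nCk>0 (m≤m+n n (n + 0)))) (∤⇒∥0 (∤-^ {n = 2 * n} p∤b)))

  1≤νℚ⇒p∣↥ : ∀ r → fin (ℤ.+ 1) ≤∞ νℚ p r → p ∣ ℤ.∣ ↥ r ∣
  1≤νℚ⇒p∣↥ r 1≤νr with ℤ.∣ ↥ r ∣
  ... | zero  = p ∣0
  ... | suc a with 1≤νr
  ...   | fin≤fin 1≤ν↥-ν↧ with ℤ.≤-trans 1≤ν↥-ν↧ (ℤ.i-j≤i (ℤ.+ νℕ p (suc a)) (ℤ.+ νℕ p (↧ₙ r)))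
  ...     | ℤ.+≤+ 1≤ν↥ = 0<νℕ⇒p∣n 1≤ν↥

  p∣↥⇒p∤↧ : ∀ r → p ∣ ℤ.∣ ↥ r ∣ → ¬ p ∣ ↧ₙ r
  p∣↥⇒p∤↧ r p∣↥ p∣↧ = >⇒≢ 1<p (↥-coprime-↧ r (p∣↥ , p∣↧))

  νℚ-fraction : ∀ q {B N} → ↥ q ℤ.* B ≡ N ℤ.* ↧ q → ¬ p ∣ ℤ.∣ B ∣ → p ^ e ∥ ℤ.∣ N ∣ → νℚ p q ≡ fin (ℤ.+ e)
  νℚ-fraction {e} q {B} {N} ↥q*B≡N*↧q p∤B p^e∥N = begin
    νℚ p q                                         ≡⟨ νℚ-nonzero p q ∣↥q∣>0 ⟩
    fin (ℤ.+ νℕ p ∣↥q∣ ℤ.- ℤ.+ νℕ p (↧ₙ q))         ≡⟨ cong₂ (λ x y → fin (ℤ.+ x ℤ.- ℤ.+ y)) ν∣↥q∣≡e (νℕ≡0 p∤↧q) ⟩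
    fin (ℤ.+ e ℤ.- ℤ.+ 0)                          ≡⟨ cong fin (ℤ.+-identityʳ (ℤ.+ e)) ⟩
    fin (ℤ.+ e)                                    ∎
    where
    open ≡-Reasoning
    ∣↥q∣ = ℤ.∣ ↥ q ∣
    ∣↥q∣*∣B∣≡∣N∣*↧q : ∣↥q∣ * ℤ.∣ B ∣ ≡ ℤ.∣ N ∣ * ↧ₙ q
    ∣↥q∣*∣B∣≡∣N∣*↧q = trans (sym (ℤ.abs-* (↥ q) B)) (trans (cong ℤ.∣_∣ ↥q*B≡N*↧q) (ℤ.abs-* N (↧ q)))
    p∤↧q : ¬ p ∣ ↧ₙ q
    p∤↧q p∣↧q = p∤B (∣-trans p∣↧q (Coprime.coprime-divisor (Coprime.sym (↥-coprime-↧ q))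
                                                            (divides ℤ.∣ N ∣ ∣↥q∣*∣B∣≡∣N∣*↧q)))
    p^e∥∣↥q∣*∣B∣ : p ^ e ∥ ∣↥q∣ * ℤ.∣ B ∣
    p^e∥∣↥q∣*∣B∣ = subst₂ (λ e n → p ^ e ∥ n) (+-identityʳ e) (sym ∣↥q∣*∣B∣≡∣N∣*↧q) (∥-* p-prime p^e∥N (∤⇒∥0 p∤↧q))
    instance
      ∣↥q∣*∣B∣≢0 : NonZero (∣↥q∣ * ℤ.∣ B ∣)
      ∣↥q∣*∣B∣≢0 = >-nonZero (∥⇒>0 p^e∥∣↥q∣*∣B∣)
    ∣↥q∣>0 : ∣↥q∣ > 0
    ∣↥q∣>0 = >-nonZero⁻¹ ∣↥q∣ {{m*n≢0⇒m≢0 ∣↥q∣}}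
    ν∣↥q∣≡e : νℕ p ∣↥q∣ ≡ e
    ν∣↥q∣≡e = begin
      νℕ p ∣↥q∣                        ≡⟨ +-identityʳ _ ⟨
      νℕ p ∣↥q∣ + 0                    ≡⟨ cong (νℕ p ∣↥q∣ +_) (νℕ≡0 p∤B) ⟨
      νℕ p ∣↥q∣ + νℕ p ℤ.∣ B ∣          ≡⟨ νℕ-* ∣↥q∣>0 (>-nonZero⁻¹ _ {{m*n≢0⇒n≢0 ∣↥q∣}}) ⟨
      νℕ p (∣↥q∣ * ℤ.∣ B ∣)             ≡⟨ νℕ-unique 1<p p^e∥∣↥q∣*∣B∣ ⟩
      e                                ∎

lemma10 : (p : ℕ) → Prime p → (r : ℚ) → fin (ℤ.+ 1) ≤∞ νℚ p r →
          (m : ℕ) → νℚ p (Q (2 * m) r) ≡ fin (ℤ.+ νℕ p ((2 * m) C m))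
lemma10 p p-prime r 1≤νr m = νℚ-fraction (Q (2 * m) r) {B} {N} ↥Q*B≡N*↧Q p∤∣B∣ (Qnum-∥ (↥ r) (↧ r) p∣↥r p∤↧r m)
  where
  open Valuation p-prime
  B = ↧ r ℤ.^ (2 * m)
  N = Qnum (↥ r) (↧ r) (2 * m)
  ↥Q*B≡N*↧Q : ↥ Q (2 * m) r ℤ.* B ≡ N ℤ.* ↧ Q (2 * m) r
  ↥Q*B≡N*↧Q = ι*q≡ι⇒↥q*B≡N*↧q B N (Q (2 * m) r) (Q-cleared (2 * m) r)
  p∣↥r = 1≤νℚ⇒p∣↥ r 1≤νr
  p∤↧r = p∣↥⇒p∤↧ r p∣↥r
  p∤∣B∣ : ¬ p ∣ ℤ.∣ B ∣
  p∤∣B∣ = subst (λ x → ¬ p ∣ x) (sym (∣i^n∣≡∣i∣^n (↧ r) (2 * m))) (∤-^ {n = 2 * m} p∤↧r)
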